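{- Let $n\ge 1$, $a\ge 3$ and $q\ge 1$ be integers, and let $K_{n,n}$ be the complete bipartite graph with both parts of size $n$. If $K_{n,n}$ has an equitable $(q,1,1)$-tree-coloring in which every color class has size either $a$ or $a+1$, then the equation $ax+(a+1)y=n$ has two solutions $(x_1,y_1)$ and $(x_2,y_2)$ in nonnegative integers (not necessarily different) such that $q=(x_1+y_1)+(x_2+y_2)$.
   Context: A $q$-coloring of a graph $G$ is a map $f:V(G)\to\{1,\dots,q\}$ (not necessarily surjective) with color classes $V_i=f^{ -1}(i)$; it is equitable if $||V_i|-|V_j||\le 1$ for all $i,j$. It is a $(q,1,1)$-tree-coloring if for every $i$, each connected component of $G[V_i]$ is a tree of maximum degree at most $1$ and diameter at most $1$ (i.e., $G[V_i]$ is a matching plus isolated vertices). -}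

module Defs where

open import Data.Nat using (ℕ; _≤_; _+_; _*_; suc)
open import Data.Fin using (Fin)
open import Data.Fin.Properties using (_≟_)
open import Data.Sum using (_⊎_; inj₁; inj₂)
open import Data.Product using (_×_; Σ; ∃)
open import Data.List using (List; length; filter; map; _++_)
open import Data.List using (allFin)
open import Data.Empty using (⊥)
open import Data.Unit using (⊤)
open import Relation.Binary.PropositionalEquality using (_≡_)
open import Relation.Nullary using (¬_)
open import Relation.Unary using (Pred)

KV : ℕ → Set
KV n = Fin n ⊎ Fin n

KAdj : ∀ {n} → KV n → KV n → Set
KAdj (inj₁ _) (inj₁ _) = ⊥
KAdj (inj₁ _) (inj₂ _) = ⊤
KAdj (inj₂ _) (inj₁ _) = ⊤
KAdj (inj₂ _) (inj₂ _) = ⊥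

allKV : (n : ℕ) → List (KV n)
allKV n = map inj₁ (allFin n) ++ map inj₂ (allFin n)

Coloring : ℕ → ℕ → Set
Coloring n q = KV n → Fin q

classSize : ∀ {n q} → Coloring n q → Fin q → ℕ
classSize {n} f i = length (filter (λ v → f v ≟ i) (allKV n))

Equitable : ∀ {n q} → Coloring n q → Set
Equitable {n} {q} f = ∀ (i j : Fin q) → classSize f i ≤ suc (classSize f j)

-- (q,1,1)-tree-coloring: every component of G[V_i] is a tree with maximum
-- degree ≤ 1 and diameter ≤ 1, i.e. G[V_i] is a matching plus isolated
-- vertices: every vertex has at most one neighbour of its own colour.
TreeColoring111 : ∀ {n q} → Coloring n q → Set
TreeColoring111 {n} f =
  ∀ (v u w : KV n) → KAdj v u → KAdj v w → f u ≡ f v → f w ≡ f v → u ≡ w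

Sol : ℕ → ℕ → ℕ → ℕ → Set
Sol a n x y = a * x + (a + 1) * y ≡ n

-- A vertex of one part of K_{n,n} is adjacent to the whole other part and has at most one
-- neighbour of its own colour, so a colour class meeting both parts has at most two vertices.
-- Since a ≥ 3, every class lies inside one part; each part is thus partitioned into classes of
-- sizes a and a + 1, and counting these classes part by part gives the two solutions, every
-- colour being counted exactly once.
module Submission where

open import Defs
open import Data.Nat using (ℕ; zero; suc; _≤_; _+_; _*_; z≤n; s≤s)
import Data.Nat.Properties as ℕ
open import Data.Bool using (if_then_else_)
open import Data.Fin using (Fin)
open import Data.Fin.Properties using (_≟_)
open import Data.Sum using (_⊎_; inj₁; inj₂)
open import Data.Sum.Properties using (inj₁-injective; inj₂-injective)
open import Data.Product using (_×_; ∃-syntax; _,_)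
open import Data.List using (List; []; _∷_; length; filter; map; _++_; allFin)
open import Data.List.Properties using (filter-++; length-++; length-map; length-tabulate)
open import Data.List.Membership.Propositional using (_∈_)
open import Data.List.Membership.Propositional.Properties using (∈-filter⁻; ∈-map⁻)
open import Data.List.Relation.Unary.Any using (here; there)
open import Data.List.Relation.Unary.All using (_∷_)
open import Data.List.Relation.Unary.AllPairs using (_∷_)
open import Data.List.Relation.Unary.Unique.Propositional using (Unique)
import Data.List.Relation.Unary.Unique.Propositional.Properties as Unique
open import Data.Unit using (tt)
open import Function using (_∘_)
open import Relation.Nullary using (Dec; does; ¬_; yes; no; contradiction)
open import Relation.Nullary.Decidable using (dec-true; dec-false)
open import Relation.Binary.PropositionalEquality
  using (_≡_; _≢_; refl; sym; trans; cong; cong₂; subst; module ≡-Reasoning)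
open import Algebra.Properties.Semiring.Sum ℕ.+-*-semiring
  using (sum-syntax; sum-cong-≗; sum-replicate-zero; ∑-distrib-+; *-distribˡ-sum)

open ≡-Reasoning

indicator : ∀ {P : Set} → Dec P → ℕ
indicator d = if does d then 1 else 0

indicator-yes : ∀ {P : Set} (d : Dec P) → P → indicator d ≡ 1
indicator-yes d p rewrite dec-true d p = refl

indicator-no : ∀ {P : Set} (d : Dec P) → ¬ P → indicator d ≡ 0
indicator-no d ¬p rewrite dec-false d ¬p = refl

∑-ones : ∀ q → ∑[ i < q ] 1 ≡ q
∑-ones zero = refl
∑-ones (suc q) = cong suc (∑-ones q)

∑-indicator-≟ : ∀ {q} (j : Fin q) → ∑[ i < q ] indicator (j ≟ i) ≡ 1
∑-indicator-≟ {suc q} Fin.zero = cong suc (sum-replicate-zero q)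
∑-indicator-≟ {suc q} (Fin.suc j) = ∑-indicator-≟ j

∑-linear : ∀ {q} (c x y : Fin q → ℕ) a b → (∀ i → c i ≡ a * x i + b * y i) →
           ∑[ i < q ] c i ≡ a * ∑[ i < q ] x i + b * ∑[ i < q ] y i
∑-linear {q} c x y a b c≡ = begin
  ∑[ i < q ] c i                               ≡⟨ sum-cong-≗ c≡ ⟩
  ∑[ i < q ] (a * x i + b * y i)               ≡⟨ ∑-distrib-+ (λ i → a * x i) (λ i → b * y i) ⟩
  ∑[ i < q ] (a * x i) + ∑[ i < q ] (b * y i)  ≡⟨ sym (cong₂ _+_ (*-distribˡ-sum a x) (*-distribˡ-sum b y)) ⟩
  a * ∑[ i < q ] x i + b * ∑[ i < q ] y i      ∎

count : ∀ {A : Set} {q} → (A → Fin q) → Fin q → List A → ℕ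
count g i xs = length (filter (λ x → g x ≟ i) xs)

count-∷ : ∀ {A : Set} {q} (g : A → Fin q) i x xs →
          count g i (x ∷ xs) ≡ indicator (g x ≟ i) + count g i xs
count-∷ g i x xs with g x ≟ i
... | yes _ = refl
... | no _ = refl

count-++ : ∀ {A : Set} {q} (g : A → Fin q) i xs ys →
           count g i (xs ++ ys) ≡ count g i xs + count g i ys
count-++ g i xs ys =
  trans (cong length (filter-++ (λ x → g x ≟ i) xs ys)) (length-++ (filter (λ x → g x ≟ i) xs))

∑-count : ∀ {A : Set} {q} (g : A → Fin q) xs → ∑[ i < q ] count g i xs ≡ length xs
∑-count {q = q} g [] = sum-replicate-zero q
∑-count {q = q} g (x ∷ xs) = begin
  ∑[ i < q ] count g i (x ∷ xs)
    ≡⟨ sum-cong-≗ (λ i → count-∷ g i x xs) ⟩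
  ∑[ i < q ] (indicator (g x ≟ i) + count g i xs)
    ≡⟨ ∑-distrib-+ (λ i → indicator (g x ≟ i)) (λ i → count g i xs) ⟩
  ∑[ i < q ] indicator (g x ≟ i) + ∑[ i < q ] count g i xs
    ≡⟨ cong₂ _+_ (∑-indicator-≟ (g x)) (∑-count g xs) ⟩
  suc (length xs) ∎

count-witness : ∀ {A : Set} {q} (g : A → Fin q) i xs → 1 ≤ count g i xs → ∃[ x ] (x ∈ xs × g x ≡ i)
count-witness g i (x ∷ xs) pos with g x ≟ i
... | yes gx≡i = x , here refl , gx≡i
... | no _ with count-witness g i xs pos
...   | y , y∈xs , gy≡i = y , there y∈xs , gy≡i

unique∧allEqual⇒length≤1 : ∀ {A : Set} {zs : List A} → Unique zs →
                           (∀ {u w} → u ∈ zs → w ∈ zs → u ≡ w) → length zs ≤ 1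
unique∧allEqual⇒length≤1 {zs = []} _ _ = z≤n
unique∧allEqual⇒length≤1 {zs = _ ∷ []} _ _ = s≤s z≤n
unique∧allEqual⇒length≤1 {zs = _ ∷ _ ∷ _} ((u≢w ∷ _) ∷ _) allEqual =
  contradiction (allEqual (here refl) (there (here refl))) u≢w

count≤1-if-completelyJoined : ∀ {n q} {f : Coloring n q} → TreeColoring111 f →
  ∀ i xs ys → (∀ {v u} → v ∈ xs → u ∈ ys → KAdj v u) → Unique ys →
  1 ≤ count f i xs → count f i ys ≤ 1
count≤1-if-completelyJoined {f = f} tree i xs ys joined unique pos
  with count-witness f i xs pos
... | v , v∈xs , fv≡i =
  unique∧allEqual⇒length≤1 (Unique.filter⁺ (λ u → f u ≟ i) unique) sameColour⇒equal
  where
  sameColour⇒equal : ∀ {u w} → u ∈ filter (λ u → f u ≟ i) ys → w ∈ filter (λ u → f u ≟ i) ys → u ≡ w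
  sameColour⇒equal u∈ w∈ with ∈-filter⁻ (λ u → f u ≟ i) u∈ | ∈-filter⁻ (λ u → f u ≟ i) w∈
  ... | u∈ys , fu≡i | w∈ys , fw≡i =
    tree v _ _ (joined v∈xs u∈ys) (joined v∈xs w∈ys) (trans fu≡i (sym fv≡i)) (trans fw≡i (sym fv≡i))

left right : ∀ n → List (KV n)
left n = map inj₁ (allFin n)
right n = map inj₂ (allFin n)

left-right-joined : ∀ {n} {v u : KV n} → v ∈ left n → u ∈ right n → KAdj v u
left-right-joined v∈ u∈ with ∈-map⁻ inj₁ v∈ | ∈-map⁻ inj₂ u∈
... | _ , _ , refl | _ , _ , refl = tt

right-left-joined : ∀ {n} {v u : KV n} → v ∈ right n → u ∈ left n → KAdj v u
right-left-joined v∈ u∈ with ∈-map⁻ inj₂ v∈ | ∈-map⁻ inj₁ u∈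
... | _ , _ , refl | _ , _ , refl = tt

∑-count-side : ∀ {n q} (f : Coloring n q) (inj : Fin n → KV n) → ∑[ i < q ] count f i (map inj (allFin n)) ≡ n
∑-count-side {n} f inj =
  trans (∑-count f (map inj (allFin n))) (trans (length-map inj (allFin n)) (length-tabulate (λ j → j)))

classSize≡left+right : ∀ {n q} (f : Coloring n q) i → classSize f i ≡ count f i (left n) + count f i (right n)
classSize≡left+right {n} f i = count-++ f i (left n) (right n)

sum≥3⇒one-summand-zero : ∀ {c₁ c₂} → 3 ≤ c₁ + c₂ → (1 ≤ c₁ → c₂ ≤ 1) → (1 ≤ c₂ → c₁ ≤ 1) → c₁ ≡ 0 ⊎ c₂ ≡ 0
sum≥3⇒one-summand-zero {zero} _ _ _ = inj₁ refl
sum≥3⇒one-summand-zero {suc _} {zero} _ _ _ = inj₂ refl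
sum≥3⇒one-summand-zero {suc _} {suc _} 3≤ ≤1₂ ≤1₁ with ℕ.≤-trans 3≤ (ℕ.+-mono-≤ (≤1₁ (s≤s z≤n)) (≤1₂ (s≤s z≤n)))
... | s≤s (s≤s ())

large-class-in-one-side : ∀ {n q} {f : Coloring n q} → TreeColoring111 f → ∀ i → 3 ≤ classSize f i →
                          count f i (left n) ≡ 0 ⊎ count f i (right n) ≡ 0
large-class-in-one-side {n} {f = f} tree i 3≤ =
  sum≥3⇒one-summand-zero (subst (3 ≤_) (classSize≡left+right f i) 3≤)
    (count≤1-if-completelyJoined tree i (left n) (right n) left-right-joined
      (Unique.map⁺ inj₂-injective (Unique.allFin⁺ n)))
    (count≤1-if-completelyJoined tree i (right n) (left n) right-left-joined
      (Unique.map⁺ inj₁-injective (Unique.allFin⁺ n)))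

Admissible : ℕ → ℕ → Set
Admissible a s = s ≡ a ⊎ s ≡ a + 1

Placement : ℕ → ℕ → ℕ → Set
Placement a c₁ c₂ = (c₁ ≡ 0 × Admissible a c₂) ⊎ (c₂ ≡ 0 × Admissible a c₁)

admissible⇒≥ : ∀ {a s} → Admissible a s → a ≤ s
admissible⇒≥ (inj₁ refl) = ℕ.≤-refl
admissible⇒≥ {a} (inj₂ refl) = ℕ.m≤m+n a 1

placement : ∀ {a c₁ c₂} → Admissible a (c₁ + c₂) → c₁ ≡ 0 ⊎ c₂ ≡ 0 → Placement a c₁ c₂
placement adm (inj₁ refl) = inj₁ (refl , adm)
placement {c₁ = c₁} adm (inj₂ refl) = inj₂ (refl , subst (Admissible _) (ℕ.+-identityʳ c₁) adm)

placement-left : ∀ {a c₁ c₂} → Placement a c₁ c₂ → c₁ ≡ 0 ⊎ Admissible a c₁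
placement-left (inj₁ (c₁≡0 , _)) = inj₁ c₁≡0
placement-left (inj₂ (_ , adm)) = inj₂ adm

placement-right : ∀ {a c₁ c₂} → Placement a c₁ c₂ → c₂ ≡ 0 ⊎ Admissible a c₂
placement-right (inj₁ (_ , adm)) = inj₂ adm
placement-right (inj₂ (c₂≡0 , _)) = inj₁ c₂≡0

sides-placed : ∀ {n q a} {f : Coloring n q} → TreeColoring111 f → 3 ≤ a →
               (∀ i → Admissible a (classSize f i)) →
               ∀ i → Placement a (count f i (left n)) (count f i (right n))
sides-placed {f = f} tree 3≤a sizes i =
  placement (subst (Admissible _) (classSize≡left+right f i) (sizes i))
    (large-class-in-one-side tree i (ℕ.≤-trans 3≤a (admissible⇒≥ (sizes i))))

sizeIs : ℕ → ℕ → ℕ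
sizeIs s t = indicator (s ℕ.≟ t)

a≢a+1 : ∀ a → a ≢ a + 1
a≢a+1 a a≡a+1 = ℕ.m≢1+n+m a {0} (trans a≡a+1 (ℕ.+-comm a 1))

0≢a+1 : ∀ a → 0 ≢ a + 1
0≢a+1 a 0≡a+1 = ℕ.1+n≢0 (sym (trans 0≡a+1 (ℕ.+-comm a 1)))

admissible-sizeIs : ∀ {a s} → Admissible a s → sizeIs s a + sizeIs s (a + 1) ≡ 1
admissible-sizeIs {a} (inj₁ refl) =
  cong₂ _+_ (indicator-yes (a ℕ.≟ a) refl) (indicator-no (a ℕ.≟ a + 1) (a≢a+1 a))
admissible-sizeIs {a} (inj₂ refl) =
  cong₂ _+_ (indicator-no (a + 1 ℕ.≟ a) (a≢a+1 a ∘ sym)) (indicator-yes (a + 1 ℕ.≟ a + 1) refl)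

zero-sizeIs : ∀ {a} → a ≢ 0 → sizeIs 0 a + sizeIs 0 (a + 1) ≡ 0
zero-sizeIs {a} a≢0 = cong₂ _+_ (indicator-no (0 ℕ.≟ a) (a≢0 ∘ sym)) (indicator-no (0 ℕ.≟ a + 1) (0≢a+1 a))

size≡combination : ∀ {a s} → a ≢ 0 → s ≡ 0 ⊎ Admissible a s → s ≡ a * sizeIs s a + (a + 1) * sizeIs s (a + 1)
size≡combination {a} a≢0 (inj₁ refl) rewrite indicator-no (0 ℕ.≟ a) (a≢0 ∘ sym) | indicator-no (0 ℕ.≟ a + 1) (0≢a+1 a)
  = sym (cong₂ _+_ (ℕ.*-zeroʳ a) (ℕ.*-zeroʳ (a + 1)))
size≡combination {a} _ (inj₂ (inj₁ refl)) rewrite indicator-yes (a ℕ.≟ a) refl | indicator-no (a ℕ.≟ a + 1) (a≢a+1 a)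
  = sym (trans (cong₂ _+_ (ℕ.*-identityʳ a) (ℕ.*-zeroʳ (a + 1))) (ℕ.+-identityʳ a))
size≡combination {a} _ (inj₂ (inj₂ refl)) rewrite indicator-no (a + 1 ℕ.≟ a) (a≢a+1 a ∘ sym) | indicator-yes (a + 1 ℕ.≟ a + 1) refl
  = sym (trans (cong (_+ (a + 1) * 1) (ℕ.*-zeroʳ a)) (ℕ.*-identityʳ (a + 1)))

placement-sizeIs : ∀ {a c₁ c₂} → a ≢ 0 → Placement a c₁ c₂ →
                   1 ≡ (sizeIs c₁ a + sizeIs c₁ (a + 1)) + (sizeIs c₂ a + sizeIs c₂ (a + 1))
placement-sizeIs a≢0 (inj₁ (refl , adm)) = sym (cong₂ _+_ (zero-sizeIs a≢0) (admissible-sizeIs adm))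
placement-sizeIs a≢0 (inj₂ (refl , adm)) = sym (cong₂ _+_ (admissible-sizeIs adm) (zero-sizeIs a≢0))

classesOfSize : ∀ {q} → (Fin q → ℕ) → ℕ → ℕ
classesOfSize {q} c s = ∑[ i < q ] sizeIs (c i) s

classesOfSize-solves : ∀ {q a n} → a ≢ 0 → (c : Fin q → ℕ) → (∀ i → c i ≡ 0 ⊎ Admissible a (c i)) →
                       ∑[ i < q ] c i ≡ n → Sol a n (classesOfSize c a) (classesOfSize c (a + 1))
classesOfSize-solves {a = a} a≢0 c sizes total = trans
  (sym (∑-linear c (λ i → sizeIs (c i) a) (λ i → sizeIs (c i) (a + 1)) a (a + 1) (size≡combination a≢0 ∘ sizes)))
  total

classesOfSize-total : ∀ {q a} → a ≢ 0 → (c₁ c₂ : Fin q → ℕ) → (∀ i → Placement a (c₁ i) (c₂ i)) →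
                      q ≡ (classesOfSize c₁ a + classesOfSize c₁ (a + 1)) + (classesOfSize c₂ a + classesOfSize c₂ (a + 1))
classesOfSize-total {q} {a} a≢0 c₁ c₂ placed = begin
  q
    ≡⟨ sym (∑-ones q) ⟩
  ∑[ i < q ] 1
    ≡⟨ sum-cong-≗ (placement-sizeIs a≢0 ∘ placed) ⟩
  ∑[ i < q ] ((x₁ i + y₁ i) + (x₂ i + y₂ i))
    ≡⟨ ∑-distrib-+ (λ i → x₁ i + y₁ i) (λ i → x₂ i + y₂ i) ⟩
  ∑[ i < q ] (x₁ i + y₁ i) + ∑[ i < q ] (x₂ i + y₂ i)
    ≡⟨ cong₂ _+_ (∑-distrib-+ x₁ y₁) (∑-distrib-+ x₂ y₂) ⟩
  (classesOfSize c₁ a + classesOfSize c₁ (a + 1)) + (classesOfSize c₂ a + classesOfSize c₂ (a + 1)) ∎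
  where
  x₁ y₁ x₂ y₂ : Fin q → ℕ
  x₁ i = sizeIs (c₁ i) a
  y₁ i = sizeIs (c₁ i) (a + 1)
  x₂ i = sizeIs (c₂ i) a
  y₂ i = sizeIs (c₂ i) (a + 1)

theorem4p2 : (n a q : ℕ) → 1 ≤ n → 3 ≤ a → 1 ≤ q →
    (∃[ f ] (Equitable {n} {q} f × TreeColoring111 f ×
      (∀ (i : Fin q) → (classSize f i ≡ a) ⊎ (classSize f i ≡ a + 1)))) →
    ∃[ x₁ ] ∃[ y₁ ] ∃[ x₂ ] ∃[ y₂ ]
      (Sol a n x₁ y₁ × Sol a n x₂ y₂ × q ≡ (x₁ + y₁) + (x₂ + y₂))
theorem4p2 n a q _ 3≤a _ (f , _ , tree , sizes) =
  classesOfSize c₁ a , classesOfSize c₁ (a + 1) , classesOfSize c₂ a , classesOfSize c₂ (a + 1) ,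
  classesOfSize-solves a≢0 c₁ (placement-left ∘ placed) (∑-count-side f inj₁) ,
  classesOfSize-solves a≢0 c₂ (placement-right ∘ placed) (∑-count-side f inj₂) ,
  classesOfSize-total a≢0 c₁ c₂ placed
  where
  c₁ c₂ : Fin q → ℕ
  c₁ i = count f i (left n)
  c₂ i = count f i (right n)
  a≢0 : a ≢ 0
  a≢0 a≡0 = contradiction (subst (3 ≤_) a≡0 3≤a) λ ()
  placed : ∀ i → Placement a (c₁ i) (c₂ i)
  placed = sides-placed tree 3≤a sizes
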